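{- Let $H>0$, $K>0$, let $t_0$ be a flat tree with respect to $H$ and $K$, and let $t$ be a Union tree with $t_0\vdash^* t$. Then for any sequence $t_0\vdash t_1\vdash\cdots\vdash t_n=t$, each step with $t_{i+1}=\mathrm{push}(t_i,x,y)$ is of one of the following two forms: (a) $x$ and $y$ are light in $t_i$ and in $t_{i+1}$; or (b) $y$ is a basket in $t_i$ (and in $t_{i+1}$).
   Context: A tree is $t=(V_t,\mathrm{root}_t,\mathrm{parent}_t)$ with finite node set, a root, and a parent map on non-root nodes such that iterating it from any node reaches the root. $\mathrm{size}(t,x)$ is the number of descendants of $x$ including $x$; $\mathrm{size}(t)=\mathrm{size}(t,\mathrm{root}_t)$; depth-one nodes are children of the root. $\textsc{merge}(t,s)$ (disjoint node sets) makes $\mathrm{root}_s$ a child of $\mathrm{root}_t$. Union trees: least class of trees containing one-node trees and containing $\textsc{merge}(t,s)$ whenever $t,s$ are in it with $\mathrm{size}(t)\ge\mathrm{size}(s)$. For distinct siblings $x\ne y$ in $t$, $\mathrm{push}(t,x,y)$ has the same nodes and root, with the parent of $x$ changed to $y$. $t\vdash t'$ means $t'=\mathrm{push}(t,x,y)$ for some such $x,y$; $\vdash^*$ is its reflexive-transitive closure. A node is light if its size is $\le H$, heavy if $>H$, a basket if it has a heavy child; an empty basket is a node with exactly one child, which has size $H+1$. A tree $t_0$ is flat (w.r.t. $H>0$, $K>0$) if: (1) the depth-one basket nodes are exactly $K$ nodes, each an empty basket; (2) there is exactly one depth-one non-basket heavy node, of size $H+1$; (3) the sizes of the light depth-one nodes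 sum to $(K+1)H$; (4) every light node and every non-basket heavy node has all its proper descendants as direct children. -}

module Defs where

open import Data.Nat using (ℕ; zero; suc; _+_; _*_; _≤_; _<_; _≟_)
open import Data.List using (List; []; _∷_; length; filter; upTo; map)
open import Data.Nat.ListAction using (sum)
open import Data.List.Membership.Propositional using (_∈_; _∉_)
open import Data.List.Membership.DecPropositional _≟_ using (_∈?_)
open import Data.List.Relation.Unary.Any using (Any; any?)
open import Data.List.Relation.Unary.Unique.Propositional using (Unique)
open import Data.Product using (Σ; ∃; _×_; _,_)
open import Data.Sum using (_⊎_)
open import Relation.Nullary using (¬_; does)
open import Relation.Binary.PropositionalEquality using (_≡_; _≢_)
open import Data.Bool using (if_then_else_)
open import Function.Bundles using (_⇔_)

-- Nodes are labelled by natural numbers; the node set is a list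
-- (required to be duplicate-free by IsTree).  The parent map is a total
-- function ℕ → ℕ whose value matters only on non-root nodes.

record Tree : Set where
  constructor mkTree
  field
    nodes  : List ℕ
    root   : ℕ
    parent : ℕ → ℕ
open Tree public

up : Tree → ℕ → ℕ
up t z = if does (z ≟ root t) then root t else parent t z

iter : (ℕ → ℕ) → ℕ → ℕ → ℕ
iter f zero    z = z
iter f (suc k) z = iter f k (f z)

record IsTree (t : Tree) : Set where
  field
    uniq        : Unique (nodes t)
    root∈       : root t ∈ nodes t
    parent∈     : ∀ z → z ∈ nodes t → z ≢ root t → parent t z ∈ nodes t
    reachesRoot : ∀ z → z ∈ nodes t → ∃ λ k → iter (up t) k z ≡ root t

-- z is a descendant of x (including x itself).  In a tree every ancestor
-- is reached within |V| steps, so the bounded search is exact.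
Desc : Tree → ℕ → ℕ → Set
Desc t x z = Any (λ k → iter (up t) k z ≡ x) (upTo (suc (length (nodes t))))

desc? : (t : Tree) (x z : ℕ) → Relation.Nullary.Dec (Desc t x z)
desc? t x z = any? (λ k → iter (up t) k z ≟ x) (upTo (suc (length (nodes t))))

size : Tree → ℕ → ℕ
size t x = length (filter (desc? t x) (nodes t))

treeSize : Tree → ℕ
treeSize t = size t (root t)

Child : Tree → ℕ → ℕ → Set
Child t c x = c ∈ nodes t × c ≢ root t × parent t c ≡ x

DepthOne : Tree → ℕ → Set
DepthOne t z = Child t z (root t)

Siblings : Tree → ℕ → ℕ → Set
Siblings t x y =
  x ∈ nodes t × y ∈ nodes t × x ≢ root t × y ≢ root t × x ≢ y × parent t x ≡ parent t y

module _ (H : ℕ) where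
  Light : Tree → ℕ → Set
  Light t x = size t x ≤ H

  Heavy : Tree → ℕ → Set
  Heavy t x = H < size t x

  Basket : Tree → ℕ → Set
  Basket t x = ∃ λ c → Child t c x × Heavy t c

  EmptyBasket : Tree → ℕ → Set
  EmptyBasket t x =
    ∃ λ c → Child t c x × size t c ≡ suc H × (∀ c′ → Child t c′ x → c′ ≡ c)

  ProperDesc : Tree → ℕ → ℕ → Set
  ProperDesc t x w = w ∈ nodes t × w ≢ x × Desc t x w

  record Flat (K : ℕ) (t : Tree) : Set where
    field
      baskets      : List ℕ
      basketsUniq  : Unique baskets
      basketsLen   : length baskets ≡ K
      basketsSpec  : ∀ z → (z ∈ baskets) ⇔ (DepthOne t z × Basket t z)
      basketsEmpty : ∀ z → z ∈ baskets → EmptyBasket t z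
      h            : ℕ
      hSpec        : DepthOne t h × ¬ Basket t h × Heavy t h
      hSize        : size t h ≡ suc H
      hUnique      : ∀ z → DepthOne t z → ¬ Basket t z → Heavy t z → z ≡ h
      lights       : List ℕ
      lightsUniq   : Unique lights
      lightsSpec   : ∀ z → (z ∈ lights) ⇔ (DepthOne t z × Light t z)
      lightsSum    : sum (map (size t) lights) ≡ suc K * H
      flatBelow    : ∀ z → z ∈ nodes t → (Light t z ⊎ (Heavy t z × ¬ Basket t z)) →
                     ∀ w → ProperDesc t z w → parent t w ≡ z

push : Tree → ℕ → ℕ → Tree
push t x y = mkTree (nodes t) (root t)
  (λ z → if does (z ≟ x) then y else parent t z)

Disjoint : Tree → Tree → Set
Disjoint t s = ∀ z → z ∈ nodes t → z ∉ nodes s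

merge : Tree → Tree → Tree
merge t s = mkTree (nodes t Data.List.++ nodes s) (root t)
  (λ z → if does (z ≟ root s) then root t
         else if does (z ∈? nodes s) then parent s z else parent t z)

record _≅_ (t u : Tree) : Set where
  field
    sameNodes  : ∀ z → (z ∈ nodes t) ⇔ (z ∈ nodes u)
    sameRoot   : root t ≡ root u
    sameParent : ∀ z → z ∈ nodes t → z ≢ root t → parent t z ≡ parent u z

data UnionTree : Tree → Set where
  single : ∀ {t} → IsTree t → nodes t ≡ root t ∷ [] → UnionTree t
  merged : ∀ {t s u} → UnionTree t → UnionTree s → Disjoint t s →
           treeSize s ≤ treeSize t → IsTree u → u ≅ merge t s → UnionTree u

data PushSeq : Tree → Tree → Set where
  done : ∀ {t} → PushSeq t t
  step : ∀ {t u} (x y : ℕ) → Siblings t x y → PushSeq (push t x y) u → PushSeq t u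

AllSteps : (Tree → ℕ → ℕ → Set) → ∀ {t u} → PushSeq t u → Set
AllSteps P done              = Data.Unit.⊤
  where import Data.Unit
AllSteps P (step {t} x y _ s) = P t x y × AllSteps P s

GoodStep : ℕ → Tree → ℕ → ℕ → Set
GoodStep H t x y =
  (Light H t x × Light H t y × Light H (push t x y) x × Light H (push t x y) y)
  ⊎ (Basket H t y × Basket H (push t x y) y)

module Submission where

-- The proof compares two quantities along the push sequence.  Given H, the
-- weight of a node is H+1 if it is a basket, its size if it is heavy but
-- not a basket, and 0 if it is light; the potential of a tree is its total
-- weight.  The two quantities are the number of baskets and the potential.
--
--  * A push never destroys a basket.  If it creates none, the potential
--    does not decrease, and it stays the same only for steps of the forms
--    (a) and (b)  (modules Pushing, PushSteps).
--  * A Union tree with n nodes has potential at most n and at most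
--    n / 2(H+1) baskets, by induction along merges  (Merging, UnionTrees).
--  * A flat tree t₀ has at most 2(H+1)(K+1) nodes, at least K+1 baskets
--    and potential at least 2(H+1)(K+1)  (FlatTrees).
--
-- Hence the final Union tree t has at most as many baskets as t₀ and no
-- larger potential; since both quantities are monotone along the sequence,
-- no step changes them, so every step has one of the two allowed forms.

open import Defs
open import Data.Nat using (ℕ; _<_)


module Sums where

  open import Data.Nat using (ℕ; suc; _+_; _*_; _≤_; _<_; _≟_; z≤n; s≤s)
  open import Data.Nat.Properties
  open import Data.List using (List; []; _∷_; length; filter; map; _++_)
  open import Data.Nat.ListAction using (sum)
  open import Data.List.Membership.Propositional using (_∈_)
  open import Data.List.Relation.Unary.Any using (here; there; _─_)
  import Data.List.Relation.Unary.All as All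
  open import Data.List.Relation.Unary.AllPairs using (_∷_)
  open import Data.List.Relation.Unary.Unique.Propositional using (Unique)
  open import Data.Empty using (⊥-elim)
  open import Data.Product using (_×_; proj₁; proj₂)
  open import Relation.Nullary using (¬_; Dec; yes; no)
  open import Relation.Binary.PropositionalEquality
  open import Data.Nat.Tactic.RingSolver using (solve-∀)

  𝟙 : ∀ {p} {P : Set p} → Dec P → ℕ
  𝟙 (yes _) = 1
  𝟙 (no _)  = 0

  𝟙-yes : ∀ {p} {P : Set p} (d : Dec P) → P → 𝟙 d ≡ 1
  𝟙-yes (yes _) _ = refl
  𝟙-yes (no ¬p) p = ⊥-elim (¬p p)

  𝟙-no : ∀ {p} {P : Set p} (d : Dec P) → ¬ P → 𝟙 d ≡ 0
  𝟙-no (yes p) ¬p = ⊥-elim (¬p p)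
  𝟙-no (no _)  _  = refl

  𝟙≤1 : ∀ {p} {P : Set p} (d : Dec P) → 𝟙 d ≤ 1
  𝟙≤1 (yes _) = s≤s z≤n
  𝟙≤1 (no _)  = z≤n

  𝟙-mono : ∀ {p q} {P : Set p} {Q : Set q} (d : Dec P) (e : Dec Q) → (P → Q) → 𝟙 d ≤ 𝟙 e
  𝟙-mono (yes p) (yes _) _ = ≤-refl
  𝟙-mono (yes p) (no ¬q) f = ⊥-elim (¬q (f p))
  𝟙-mono (no _)  _       _ = z≤n

  𝟙-cong : ∀ {p q} {P : Set p} {Q : Set q} (d : Dec P) (e : Dec Q) → (P → Q) → (Q → P) → 𝟙 d ≡ 𝟙 e
  𝟙-cong d e f g = ≤-antisym (𝟙-mono d e f) (𝟙-mono e d g)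

  ∑ : (ℕ → ℕ) → List ℕ → ℕ
  ∑ f []       = 0
  ∑ f (x ∷ xs) = f x + ∑ f xs

  length-filter≡∑𝟙 : ∀ {p} {P : ℕ → Set p} (P? : ∀ x → Dec (P x)) xs →
                     length (filter P? xs) ≡ ∑ (λ z → 𝟙 (P? z)) xs
  length-filter≡∑𝟙 P? [] = refl
  length-filter≡∑𝟙 P? (x ∷ xs) with P? x
  ... | yes _ = cong suc (length-filter≡∑𝟙 P? xs)
  ... | no _  = length-filter≡∑𝟙 P? xs

  ∑≡sum∘map : ∀ f xs → ∑ f xs ≡ sum (map f xs)
  ∑≡sum∘map f []       = refl
  ∑≡sum∘map f (x ∷ xs) = cong (f x +_) (∑≡sum∘map f xs)

  ∑-const : ∀ c xs → ∑ (λ _ → c) xs ≡ length xs * c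
  ∑-const c []       = refl
  ∑-const c (x ∷ xs) = cong (c +_) (∑-const c xs)

  ∑-1 : ∀ xs → ∑ (λ _ → 1) xs ≡ length xs
  ∑-1 xs = trans (∑-const 1 xs) (*-identityʳ (length xs))

  ∑-zero : ∀ f xs → (∀ z → z ∈ xs → f z ≡ 0) → ∑ f xs ≡ 0
  ∑-zero f []       h = refl
  ∑-zero f (x ∷ xs) h rewrite h x (here refl) = ∑-zero f xs (λ z p → h z (there p))

  ∑-mono : ∀ {f g} xs → (∀ z → z ∈ xs → f z ≤ g z) → ∑ f xs ≤ ∑ g xs
  ∑-mono []       h = z≤n
  ∑-mono (x ∷ xs) h = +-mono-≤ (h x (here refl)) (∑-mono xs (λ z p → h z (there p)))

  ∑-cong : ∀ {f g} xs → (∀ z → z ∈ xs → f z ≡ g z) → ∑ f xs ≡ ∑ g xs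
  ∑-cong xs h = ≤-antisym (∑-mono xs (λ z p → ≤-reflexive (h z p)))
                          (∑-mono xs (λ z p → ≤-reflexive (sym (h z p))))

  ∑-strict : ∀ {f g} xs {z} → (∀ z → z ∈ xs → f z ≤ g z) → z ∈ xs → f z < g z → ∑ f xs < ∑ g xs
  ∑-strict (x ∷ xs) h (here refl) lt = +-mono-≤ lt (∑-mono xs (λ z p → h z (there p)))
  ∑-strict {f} (x ∷ xs) h (there q) lt =
    ≤-trans (≤-reflexive (sym (+-suc (f x) (∑ f xs))))
            (+-mono-≤ (h x (here refl)) (∑-strict xs (λ z p → h z (there p)) q lt))

  ∑-term : ∀ f xs {z} → z ∈ xs → f z ≤ ∑ f xs
  ∑-term f (x ∷ xs) (here refl) = m≤m+n (f x) (∑ f xs)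
  ∑-term f (x ∷ xs) (there p)   = ≤-trans (∑-term f xs p) (m≤n+m (∑ f xs) (f x))

  ∑-bound : ∀ f m xs → (∀ z → z ∈ xs → f z ≤ m) → ∑ f xs ≤ length xs * m
  ∑-bound f m xs h = ≤-trans (∑-mono xs h) (≤-reflexive (∑-const m xs))

  ∑-+ : ∀ f g xs → ∑ (λ z → f z + g z) xs ≡ ∑ f xs + ∑ g xs
  ∑-+ f g []       = refl
  ∑-+ f g (x ∷ xs) rewrite ∑-+ f g xs = shuffle (f x) (g x) (∑ f xs) (∑ g xs)
    where
    shuffle : ∀ a b c d → a + b + (c + d) ≡ a + c + (b + d)
    shuffle = solve-∀

  ∑-* : ∀ c f xs → ∑ (λ z → c * f z) xs ≡ c * ∑ f xs
  ∑-* c f []       = sym (*-zeroʳ c)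
  ∑-* c f (x ∷ xs) = trans (cong (c * f x +_) (∑-* c f xs)) (sym (*-distribˡ-+ c (f x) (∑ f xs)))

  ∑-++ : ∀ f xs ys → ∑ f (xs ++ ys) ≡ ∑ f xs + ∑ f ys
  ∑-++ f []       ys = refl
  ∑-++ f (x ∷ xs) ys rewrite ∑-++ f xs ys = sym (+-assoc (f x) (∑ f xs) (∑ f ys))

  ∑-comm : ∀ (F : ℕ → ℕ → ℕ) xs ys → ∑ (λ x → ∑ (F x) ys) xs ≡ ∑ (λ y → ∑ (λ x → F x y) xs) ys
  ∑-comm F []       ys = sym (∑-zero (λ _ → 0) ys (λ _ _ → refl))
  ∑-comm F (x ∷ xs) ys rewrite ∑-comm F xs ys = sym (∑-+ (F x) (λ y → ∑ (λ x → F x y) xs) ys)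

  ∑-single : ∀ f v xs → Unique xs → (∀ z → z ≢ v → f z ≡ 0) → ∑ f xs ≤ f v
  ∑-single f v []       _        h = z≤n
  ∑-single f v (x ∷ xs) (x∉ ∷ u) h with x ≟ v
  ... | yes refl = ≤-reflexive (trans (cong (f x +_) (∑-zero f xs (λ z p → h z (≢-sym (All.lookup x∉ p)))))
                                      (+-identityʳ (f x)))
  ... | no ne rewrite h x ne = ∑-single f v xs u h

  ∑-remove : ∀ f {y} xs (p : y ∈ xs) → ∑ f xs ≡ f y + ∑ f (xs ─ p)
  ∑-remove f (x ∷ xs) (here refl) = refl
  ∑-remove f {y} (x ∷ xs) (there p) rewrite ∑-remove f xs p = +-comm-front (f x) (f y) (∑ f (xs ─ p))
    where
    +-comm-front : ∀ a b c → a + (b + c) ≡ b + (a + c)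
    +-comm-front = solve-∀

  ∈-remove : ∀ {y z : ℕ} (xs : List ℕ) (p : y ∈ xs) → z ∈ xs → z ≢ y → z ∈ (xs ─ p)
  ∈-remove (x ∷ xs) (here refl) (here refl) ne = ⊥-elim (ne refl)
  ∈-remove (x ∷ xs) (here refl) (there q)   ne = q
  ∈-remove (x ∷ xs) (there p)   (here refl) ne = here refl
  ∈-remove (x ∷ xs) (there p)   (there q)   ne = there (∈-remove xs p q ne)

  ∑-subset : ∀ f ys xs → Unique ys → (∀ z → z ∈ ys → z ∈ xs) → ∑ f ys ≤ ∑ f xs
  ∑-subset f []       xs _        _ = z≤n
  ∑-subset f (y ∷ ys) xs (y∉ ∷ u) h rewrite ∑-remove f xs (h y (here refl)) =
    +-monoʳ-≤ (f y) (∑-subset f ys (xs ─ h y (here refl)) u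
      (λ z p → ∈-remove xs (h y (here refl)) (h z (there p)) (≢-sym (All.lookup y∉ p))))

  ∑-sameSet : ∀ f xs ys → Unique xs → Unique ys →
              (∀ z → z ∈ xs → z ∈ ys) → (∀ z → z ∈ ys → z ∈ xs) → ∑ f xs ≡ ∑ f ys
  ∑-sameSet f xs ys ux uy xs⊆ys ys⊆xs = ≤-antisym (∑-subset f xs ys ux xs⊆ys) (∑-subset f ys xs uy ys⊆xs)

  ∑-update : ∀ f g r xs → Unique xs → r ∈ xs → (∀ z → z ∈ xs → z ≢ r → f z ≡ g z) →
             ∑ f xs + g r ≡ ∑ g xs + f r
  ∑-update f g r (x ∷ xs) (x∉ ∷ u) (here refl) h
    rewrite ∑-cong {f} {g} xs (λ z p → h z (there p) (≢-sym (All.lookup x∉ p))) = swap-ends (f x) (∑ g xs) (g x)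
    where
    swap-ends : ∀ a b c → a + b + c ≡ c + b + a
    swap-ends = solve-∀
  ∑-update f g r (x ∷ xs) (x∉ ∷ u) (there p) h
    rewrite h x (here refl) (All.lookup x∉ p) | +-assoc (g x) (∑ f xs) (g r)
          | ∑-update f g r xs u p (λ z q → h z (there q)) = sym (+-assoc (g x) (∑ g xs) (f r))

  length≤count : ∀ {p} {P : ℕ → Set p} (P? : ∀ z → Dec (P z)) ys xs → Unique ys →
                 (∀ z → z ∈ ys → z ∈ xs × P z) → length ys ≤ ∑ (λ z → 𝟙 (P? z)) xs
  length≤count P? ys xs uniq h = begin
    length ys                    ≡⟨ sym (∑-1 ys) ⟩
    ∑ (λ _ → 1) ys               ≡⟨ ∑-cong ys (λ z p → sym (𝟙-yes (P? z) (proj₂ (h z p)))) ⟩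
    ∑ (λ z → 𝟙 (P? z)) ys        ≤⟨ ∑-subset (λ z → 𝟙 (P? z)) ys xs uniq (λ z p → proj₁ (h z p)) ⟩
    ∑ (λ z → 𝟙 (P? z)) xs        ∎
    where open ≤-Reasoning

module Ancestry where

  open Sums
  open import Data.Nat using (ℕ; zero; suc; _+_; _*_; _∸_; _≤_; _<_; _≟_; s≤s; _≤?_)
  open import Data.Nat.Properties
  open import Data.List using (length; lookup)
  open import Data.List.Membership.Propositional using (_∈_; lose)
  open import Data.List.Membership.Propositional.Properties using (∈-upTo⁺)
  open import Data.List.Relation.Unary.Any using (satisfied; index)
  open import Data.List.Relation.Unary.Any.Properties using (lookup-index)
  open import Data.Fin using (toℕ)
  open import Data.Fin.Properties using (pigeonhole; toℕ<n)
  open import Data.Product using (∃; _×_; _,_)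
  open import Data.Sum using (_⊎_; inj₁; inj₂)
  open import Data.Empty using (⊥; ⊥-elim)
  open import Relation.Nullary using (yes; no; does)
  open import Relation.Nullary.Decidable using (dec-true; dec-false)
  open import Data.Bool using (if_then_else_)
  open import Relation.Binary.PropositionalEquality

  if-≟-yes : ∀ {A : Set} m n {a b : A} → m ≡ n → (if does (m ≟ n) then a else b) ≡ a
  if-≟-yes m n eq rewrite dec-true (m ≟ n) eq = refl

  if-≟-no : ∀ {A : Set} m n {a b : A} → m ≢ n → (if does (m ≟ n) then a else b) ≡ b
  if-≟-no m n ne rewrite dec-false (m ≟ n) ne = refl

  -- This inductive form of the descendant
  -- relation Desc is the one all structural arguments use.
  data Anc (t : Tree) (a : ℕ) : ℕ → Set where
    self  : Anc t a a
    above : ∀ {z} → z ≢ root t → Anc t a (parent t z) → Anc t a z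

  module _ {t : Tree} where

    up-root : up t (root t) ≡ root t
    up-root = if-≟-yes (root t) (root t) refl

    up-nonroot : ∀ {z} → z ≢ root t → up t z ≡ parent t z
    up-nonroot {z} ne = if-≟-no z (root t) ne

    iter-root : ∀ k → iter (up t) k (root t) ≡ root t
    iter-root zero    = refl
    iter-root (suc k) rewrite up-root = iter-root k

    iter-+ : ∀ m n z → iter (up t) (m + n) z ≡ iter (up t) n (iter (up t) m z)
    iter-+ zero    n z = refl
    iter-+ (suc m) n z = iter-+ m n (up t z)

    iter→anc : ∀ {a} k z → iter (up t) k z ≡ a → Anc t a z
    iter→anc zero z refl = self
    iter→anc {a} (suc k) z eq with z ≟ root t
    ... | yes refl = subst (Anc t a) up-root (iter→anc k (up t (root t)) eq)
    ... | no ne    = above ne (iter→anc k (parent t z) (trans (cong (iter (up t) k) (sym (up-nonroot ne))) eq))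

    anc→iter : ∀ {a z} → Anc t a z → ∃ λ k → iter (up t) k z ≡ a
    anc→iter self = 0 , refl
    anc→iter (above ne p) with anc→iter p
    ... | k , eq = suc k , trans (cong (iter (up t) k) (up-nonroot ne)) eq

    anc-trans : ∀ {a b c} → Anc t a b → Anc t b c → Anc t a c
    anc-trans p self         = p
    anc-trans p (above ne q) = above ne (anc-trans p q)

    anc-of-root : ∀ {a} → Anc t a (root t) → a ≡ root t
    anc-of-root self         = refl
    anc-of-root (above ne _) = ⊥-elim (ne refl)

    anc-comparable : ∀ {a b w} → Anc t a w → Anc t b w → Anc t a b ⊎ Anc t b a
    anc-comparable self         q            = inj₂ q
    anc-comparable (above ne p) self         = inj₁ (above ne p)
    anc-comparable (above _ p)  (above _ q)  = anc-comparable p q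

    anc-parent : ∀ {a z} → Anc t a z → a ≢ z → Anc t a (parent t z)
    anc-parent self        ne = ⊥-elim (ne refl)
    anc-parent (above _ p) _  = p

    anc-child : ∀ {a w} → Anc t a w → a ≢ w → ∃ λ c → c ≢ root t × parent t c ≡ a × Anc t c w
    anc-child self ne = ⊥-elim (ne refl)
    anc-child {a} (above {z} nr p) ne with parent t z ≟ a
    ... | yes eq  = z , nr , eq , self
    ... | no ne′ with anc-child p (≢-sym ne′)
    ...   | c , cr , cp , q = c , cr , cp , above nr q

  module _ {t : Tree} (T : IsTree t) where
    open IsTree T

    up∈ : ∀ z → z ∈ nodes t → up t z ∈ nodes t
    up∈ z p with z ≟ root t
    ... | yes refl = subst (_∈ nodes t) (sym (up-root {t})) root∈
    ... | no ne    = subst (_∈ nodes t) (sym (up-nonroot {t} ne)) (parent∈ z p ne)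

    iter∈ : ∀ k z → z ∈ nodes t → iter (up t) k z ∈ nodes t
    iter∈ zero    z p = p
    iter∈ (suc k) z p = iter∈ k (up t z) (up∈ z p)

    anc∈ : ∀ {a z} → Anc t a z → z ∈ nodes t → a ∈ nodes t
    anc∈ self         p = p
    anc∈ (above ne q) p = anc∈ q (parent∈ _ p ne)

    root-anc : ∀ z → z ∈ nodes t → Anc t (root t) z
    root-anc z p with reachesRoot z p
    ... | k , eq = iter→anc {t} k z eq

    cycle⇒root : ∀ d z → z ∈ nodes t → iter (up t) (suc d) z ≡ z → z ≡ root t
    cycle⇒root d z p cyc with reachesRoot z p
    ... | m , reach = begin
        z                                      ≡⟨ sym (around m) ⟩
        iter (up t) (m * suc d) z              ≡⟨ cong (λ k → iter (up t) k z) (sym (m+[n∸m]≡n (m≤m*n m (suc d)))) ⟩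
        iter (up t) (m + (m * suc d ∸ m)) z    ≡⟨ iter-+ {t} m (m * suc d ∸ m) z ⟩
        iter (up t) (m * suc d ∸ m) (iter (up t) m z) ≡⟨ cong (iter (up t) (m * suc d ∸ m)) reach ⟩
        iter (up t) (m * suc d ∸ m) (root t)   ≡⟨ iter-root {t} (m * suc d ∸ m) ⟩
        root t                                 ∎
      where
      open ≡-Reasoning
      around : ∀ q → iter (up t) (q * suc d) z ≡ z
      around zero    = refl
      around (suc q) = trans (iter-+ {t} (suc d) (q * suc d) z) (trans (cong (iter (up t) (q * suc d)) cyc) (around q))

    acyclic : ∀ x → x ∈ nodes t → x ≢ root t → Anc t x (parent t x) → ⊥
    acyclic x p nr a with anc→iter {t} a
    ... | k , eq = nr (cycle⇒root k x p (trans (cong (iter (up t) k) (up-nonroot {t} nr)) eq))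

    -- by pigeonhole, every ancestor is reached within |V| steps
    bounded-reach : ∀ k z {a} → z ∈ nodes t → iter (up t) k z ≡ a →
                    ∃ λ k′ → k′ < suc (length (nodes t)) × iter (up t) k′ z ≡ a
    bounded-reach k z {a} p eq with k ≤? length (nodes t)
    ... | yes k≤ = k , s≤s k≤ , eq
    ... | no k>  with pigeonhole (n<1+n (length (nodes t))) (λ j → index (iter∈ (toℕ j) z p))
    ...   | i , j , i<j , same = toℕ i , <-trans i<j (toℕ<n j) , sym a≡zi
      where
      zi = iter (up t) (toℕ i) z
      d  = toℕ j ∸ suc (toℕ i)
      zi≡zj : zi ≡ iter (up t) (toℕ j) z
      zi≡zj = trans (lookup-index (iter∈ (toℕ i) z p))
                (trans (cong (lookup (nodes t)) same) (sym (lookup-index (iter∈ (toℕ j) z p))))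
      j≡i+d : toℕ j ≡ toℕ i + suc d
      j≡i+d = sym (trans (+-suc (toℕ i) d) (m+[n∸m]≡n i<j))
      zi-root : zi ≡ root t
      zi-root = cycle⇒root d zi (iter∈ (toℕ i) z p)
        (sym (trans zi≡zj (trans (cong (λ m → iter (up t) m z) j≡i+d) (iter-+ {t} (toℕ i) (suc d) z))))
      i≤k : toℕ i ≤ k
      i≤k = ≤-trans (<⇒≤ (<-trans i<j (toℕ<n j))) (≰⇒> k>)
      a≡zi : a ≡ zi
      a≡zi = begin
        a                                        ≡⟨ sym eq ⟩
        iter (up t) k z                          ≡⟨ cong (λ m → iter (up t) m z) (sym (m+[n∸m]≡n i≤k)) ⟩
        iter (up t) (toℕ i + (k ∸ toℕ i)) z      ≡⟨ iter-+ {t} (toℕ i) (k ∸ toℕ i) z ⟩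
        iter (up t) (k ∸ toℕ i) zi               ≡⟨ cong (iter (up t) (k ∸ toℕ i)) zi-root ⟩
        iter (up t) (k ∸ toℕ i) (root t)         ≡⟨ iter-root {t} (k ∸ toℕ i) ⟩
        root t                                   ≡⟨ sym zi-root ⟩
        zi                                       ∎
        where open ≡-Reasoning

    anc→desc : ∀ {a z} → z ∈ nodes t → Anc t a z → Desc t a z
    anc→desc p q with anc→iter {t} q
    ... | k , eq with bounded-reach k _ p eq
    ...   | k′ , lt , eq′ = lose (∈-upTo⁺ lt) eq′

  desc→anc : ∀ {t a z} → Desc t a z → Anc t a z
  desc→anc {z = z} d with satisfied d
  ... | k , eq = iter→anc k z eq

module Sizes where

  open Sums
  open Ancestry
  open import Data.Nat using (ℕ; suc; _+_; _≤_; _≟_; z≤n; s≤s)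
  open import Data.Nat.Properties
  open import Data.List using (List; length)
  import Data.List.Properties as List
  open import Data.List.Membership.Propositional using (_∈_)
  open import Data.List.Relation.Unary.Unique.Propositional using (Unique)
  open import Data.Product using (_,_)
  open import Relation.Nullary using (¬_; Dec; yes; no)
  open import Relation.Nullary.Decidable using (_×-dec_; ¬?)
  open import Relation.Binary.PropositionalEquality

  below : Tree → ℕ → ℕ → ℕ
  below t a w = 𝟙 (desc? t a w)

  size≡∑below : ∀ t a → size t a ≡ ∑ (below t a) (nodes t)
  size≡∑below t a = length-filter≡∑𝟙 (desc? t a) (nodes t)

  size≤length : ∀ t a → size t a ≤ length (nodes t)
  size≤length t a = List.length-filter (desc? t a) (nodes t)

  below-no : ∀ {t a w} → ¬ Anc t a w → below t a w ≡ 0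
  below-no {t} {a} {w} ¬anc = 𝟙-no (desc? t a w) (λ d → ¬anc (desc→anc d))

  childCount : ∀ {m} {M : ℕ → Set m} → Tree → (∀ z → Dec (M z)) → ℕ → ℕ
  childCount t M? b = ∑ (λ c → 𝟙 ((¬? (c ≟ root t) ×-dec (parent t c ≟ b)) ×-dec M? c)) (nodes t)

  module _ {t : Tree} (T : IsTree t) where
    open IsTree T

    below-yes : ∀ {a w} → w ∈ nodes t → Anc t a w → below t a w ≡ 1
    below-yes {a} {w} p q = 𝟙-yes (desc? t a w) (anc→desc T p q)

    below-mono : ∀ {a b} w → w ∈ nodes t → (Anc t a w → Anc t b w) → below t a w ≤ below t b w
    below-mono {a} {b} w p f = 𝟙-mono (desc? t a w) (desc? t b w) (λ d → anc→desc T p (f (desc→anc d)))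

    size-root : size t (root t) ≡ length (nodes t)
    size-root = ≤-antisym (size≤length t (root t)) (begin
      length (nodes t)                 ≡⟨ sym (∑-1 (nodes t)) ⟩
      ∑ (λ _ → 1) (nodes t)            ≡⟨ ∑-cong (nodes t) (λ w p → sym (below-yes p (root-anc T w p))) ⟩
      ∑ (below t (root t)) (nodes t)   ≡⟨ sym (size≡∑below t (root t)) ⟩
      size t (root t)                  ∎)
      where open ≤-Reasoning

    size-pos : ∀ {a} → a ∈ nodes t → 1 ≤ size t a
    size-pos {a} p rewrite size≡∑below t a =
      ≤-trans (≤-reflexive (sym (below-yes p self))) (∑-term (below t a) (nodes t) p)

    size-child : ∀ {c} → c ∈ nodes t → c ≢ root t → suc (size t c) ≤ size t (parent t c)
    size-child {c} p nr rewrite size≡∑below t c | size≡∑below t (parent t c) =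
      ∑-strict (nodes t) (λ w q → below-mono w q (anc-trans (above nr self))) pc
        (≤-trans (s≤s (≤-reflexive (below-no (acyclic T c p nr)))) (≤-reflexive (sym (below-yes pc self))))
      where pc = parent∈ c p nr

    -- every descendant of v is v itself or lies below a child of v, so if C
    -- lists all children of v then size v ≤ 1 + Σ_{c ∈ C} size c
    size-decompose : ∀ v (C : List ℕ) → (∀ c → c ∈ nodes t → c ≢ root t → parent t c ≡ v → c ∈ C) →
                     size t v ≤ 1 + ∑ (size t) C
    size-decompose v C children⊆C = begin
      size t v                                                        ≡⟨ size≡∑below t v ⟩
      ∑ (below t v) (nodes t)                                         ≤⟨ ∑-mono (nodes t) split ⟩
      ∑ (λ w → 𝟙 (w ≟ v) + ∑ (λ c → below t c w) C) (nodes t)         ≡⟨ ∑-+ (λ w → 𝟙 (w ≟ v)) _ (nodes t) ⟩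
      ∑ (λ w → 𝟙 (w ≟ v)) (nodes t) + ∑ (λ w → ∑ (λ c → below t c w) C) (nodes t)
        ≤⟨ +-mono-≤ at-most-one (≤-reflexive (∑-comm (λ w c → below t c w) (nodes t) C)) ⟩
      1 + ∑ (λ c → ∑ (below t c) (nodes t)) C                          ≡⟨ cong suc (∑-cong C (λ c _ → sym (size≡∑below t c))) ⟩
      1 + ∑ (size t) C                                                ∎
      where
      open ≤-Reasoning
      at-most-one : ∑ (λ w → 𝟙 (w ≟ v)) (nodes t) ≤ 1
      at-most-one = ≤-trans (∑-single (λ w → 𝟙 (w ≟ v)) v (nodes t) uniq (λ z ne → 𝟙-no (z ≟ v) ne)) (𝟙≤1 (v ≟ v))
      split : ∀ w → w ∈ nodes t → below t v w ≤ 𝟙 (w ≟ v) + ∑ (λ c → below t c w) C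
      split w wp with desc? t v w
      ... | no _  = z≤n
      ... | yes d with w ≟ v
      ...   | yes _ = s≤s z≤n
      ...   | no ne with anc-child (desc→anc d) (≢-sym ne)
      ...     | c , cr , pc , q = ≤-trans (≤-reflexive (sym (below-yes wp q)))
                                    (∑-term (λ c → below t c w) C (children⊆C c (anc∈ T q wp) cr pc))

    -- each node has one parent, so children of distinct nodes are distinct:
    -- summing childCount over a duplicate-free list counts each node at most once
    ∑-childCount : ∀ {m} {M : ℕ → Set m} (M? : ∀ z → Dec (M z)) (P : List ℕ) → Unique P →
                   ∑ (childCount t M?) P ≤ ∑ (λ z → 𝟙 (M? z)) (nodes t)
    ∑-childCount M? P uniqP = begin
      ∑ (childCount t M?) P                  ≡⟨ ∑-comm F P (nodes t) ⟩
      ∑ (λ c → ∑ (λ b → F b c) P) (nodes t)  ≤⟨ ∑-mono (nodes t) (λ c _ → one-parent c) ⟩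
      ∑ (λ z → 𝟙 (M? z)) (nodes t)           ∎
      where
      open ≤-Reasoning
      F : ℕ → ℕ → ℕ
      F b c = 𝟙 ((¬? (c ≟ root t) ×-dec (parent t c ≟ b)) ×-dec M? c)
      one-parent : ∀ c → ∑ (λ b → F b c) P ≤ 𝟙 (M? c)
      one-parent c = ≤-trans (∑-single (λ b → F b c) (parent t c) P uniqP
                               (λ b ne → 𝟙-no _ (λ ((_ , pc) , _) → ne (sym pc))))
                             (𝟙-mono _ (M? c) (λ (_ , m) → m))

module Pushing where

  open Sums
  open Ancestry
  open Sizes
  open import Data.Nat using (ℕ; _+_; _≤_; _≟_)
  open import Data.Nat.Properties
  open import Data.List.Membership.Propositional using (_∈_)
  open import Data.Product using (_×_; _,_; proj₁; proj₂)
  open import Data.Sum using (_⊎_; inj₁; inj₂)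
  open import Data.Empty using (⊥; ⊥-elim)
  open import Relation.Nullary using (yes; no)
  open import Relation.Binary.PropositionalEquality

  -- The effect of one push t ⊢ push t x y on ancestry and sizes: the subtree
  -- of x moves below y, so y gains size t x and every other size is unchanged.
  module Push {t : Tree} (T : IsTree t) {x y : ℕ} (sib : Siblings t x y) where
    open IsTree T

    t′ : Tree
    t′ = push t x y

    x∈ : x ∈ nodes t
    x∈ = proj₁ sib
    y∈ : y ∈ nodes t
    y∈ = proj₁ (proj₂ sib)
    x≢root : x ≢ root t
    x≢root = proj₁ (proj₂ (proj₂ sib))
    y≢root : y ≢ root t
    y≢root = proj₁ (proj₂ (proj₂ (proj₂ sib)))
    x≢y : x ≢ y
    x≢y = proj₁ (proj₂ (proj₂ (proj₂ (proj₂ sib))))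
    px≡py : parent t x ≡ parent t y
    px≡py = proj₂ (proj₂ (proj₂ (proj₂ (proj₂ sib))))

    parent′-x : parent t′ x ≡ y
    parent′-x = if-≟-yes x x refl

    parent′-other : ∀ {z} → z ≢ x → parent t′ z ≡ parent t z
    parent′-other {z} ne = if-≟-no z x ne

    parent′-y : parent t′ y ≡ parent t x
    parent′-y = trans (parent′-other (≢-sym x≢y)) (sym px≡py)

    -- ancestry only grows: x's old parent is still reached, through y
    anc-preserved : ∀ {a z} → Anc t a z → Anc t′ a z
    anc-preserved self = self
    anc-preserved {a} (above {z} nr q) with z ≟ x
    ... | yes refl = above x≢root (subst (Anc t′ a) (sym parent′-x)
                       (above y≢root (subst (Anc t′ a) (sym parent′-y) (anc-preserved q))))
    ... | no ne    = above nr (subst (Anc t′ a) (sym (parent′-other ne)) (anc-preserved q))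

    anc-moved : ∀ {z} → Anc t x z → Anc t′ y z
    anc-moved self = above x≢root (subst (Anc t′ y) (sym parent′-x) self)
    anc-moved (above {z} nr q) with z ≟ x
    ... | yes refl = above x≢root (subst (Anc t′ y) (sym parent′-x) self)
    ... | no ne    = above nr (subst (Anc t′ y) (sym (parent′-other ne)) (anc-moved q))

    anc-reflected : ∀ {a z} → Anc t′ a z → Anc t a z ⊎ (Anc t x z × Anc t a y)
    anc-reflected self = inj₁ self
    anc-reflected {a} (above {z} nr q) with anc-reflected q | z ≟ x
    ... | r | yes refl = inj₂ (self , via-y (subst (λ v → Anc t a v ⊎ (Anc t x v × Anc t a y)) parent′-x r))
      where
      via-y : Anc t a y ⊎ (Anc t x y × Anc t a y) → Anc t a y
      via-y (inj₁ u)       = u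
      via-y (inj₂ (_ , u)) = u
    ... | r | no ne with subst (λ v → Anc t a v ⊎ (Anc t x v × Anc t a y)) (parent′-other ne) r
    ...   | inj₁ u       = inj₁ (above nr u)
    ...   | inj₂ (u , v) = inj₂ (above nr u , v)

    T′ : IsTree t′
    T′ = record { uniq = uniq ; root∈ = root∈ ; parent∈ = parent′∈
                ; reachesRoot = λ z p → anc→iter (anc-preserved (root-anc T z p)) }
      where
      parent′∈ : ∀ z → z ∈ nodes t → z ≢ root t → parent t′ z ∈ nodes t
      parent′∈ z p nr with z ≟ x
      ... | yes refl = subst (_∈ nodes t) (sym parent′-x) y∈
      ... | no ne    = subst (_∈ nodes t) (sym (parent′-other ne)) (parent∈ z p nr)

    disjoint-subtrees : ∀ {w} → Anc t y w → Anc t x w → ⊥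
    disjoint-subtrees ay ax with anc-comparable ay ax
    ... | inj₁ y-above-x = acyclic T y y∈ y≢root (subst (Anc t y) px≡py (anc-parent y-above-x (≢-sym x≢y)))
    ... | inj₂ x-above-y = acyclic T x x∈ x≢root (subst (Anc t x) (sym px≡py) (anc-parent x-above-y x≢y))

    parent-x≢y : parent t x ≢ y
    parent-x≢y e = acyclic T y y∈ y≢root (subst (Anc t y) (trans (sym e) px≡py) self)

    anc-reflected-other : ∀ {a w} → a ≢ y → Anc t′ a w → Anc t a w
    anc-reflected-other ne q with anc-reflected q
    ... | inj₁ u       = u
    ... | inj₂ (u , v) = anc-trans (subst (Anc t _) (sym px≡py) (anc-parent v ne)) (anc-trans (above x≢root self) u)

    size-other : ∀ {a} → a ≢ y → size t′ a ≡ size t a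
    size-other {a} ne rewrite size≡∑below t′ a | size≡∑below t a =
      ∑-cong (nodes t) (λ w p → 𝟙-cong (desc? t′ a w) (desc? t a w)
        (λ d → anc→desc T p (anc-reflected-other ne (desc→anc d)))
        (λ d → anc→desc T′ p (anc-preserved (desc→anc d))))

    size-y : size t′ y ≡ size t y + size t x
    size-y rewrite size≡∑below t′ y | size≡∑below t y | size≡∑below t x =
      trans (∑-cong (nodes t) pointwise) (∑-+ (below t y) (below t x) (nodes t))
      where
      pointwise : ∀ w → w ∈ nodes t → below t′ y w ≡ below t y w + below t x w
      pointwise w p with desc? t y w | desc? t x w
      ... | yes dy | yes dx = ⊥-elim (disjoint-subtrees (desc→anc dy) (desc→anc dx))
      ... | yes dy | no _   = below-yes T′ p (anc-preserved (desc→anc dy))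
      ... | no _   | yes dx = below-yes T′ p (anc-moved (desc→anc dx))
      ... | no ny  | no nx  = below-no (λ q → neither (anc-reflected q))
        where
        neither : Anc t y w ⊎ (Anc t x w × Anc t y y) → ⊥
        neither (inj₁ u)       = ny (anc→desc T p u)
        neither (inj₂ (u , _)) = nx (anc→desc T p u)

    size-mono : ∀ a → size t a ≤ size t′ a
    size-mono a with a ≟ y
    ... | yes refl = ≤-trans (m≤m+n (size t y) (size t x)) (≤-reflexive (sym size-y))
    ... | no ne    = ≤-reflexive (sym (size-other ne))

  nodes-seq : ∀ {t u} → PushSeq t u → nodes u ≡ nodes t
  nodes-seq done           = refl
  nodes-seq (step x y _ s) = nodes-seq s

module Potential (H : ℕ) where

  open Sums
  open Sizes
  open import Data.Nat using (suc; _≤_; _<_; _≟_; _<?_; z≤n; s≤s)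
  open import Data.Nat.Properties
  open import Data.List using (length)
  open import Data.List.Membership.Propositional using (find; lose)
  open import Data.List.Relation.Unary.Any using (Any; any?)
  open import Data.Product using (_×_; _,_; proj₁)
  open import Data.Empty using (⊥-elim)
  open import Relation.Nullary using (¬_; Dec; yes; no)
  open import Relation.Nullary.Decidable using (_×-dec_; map′; ¬?)
  open import Relation.Binary.PropositionalEquality

  heavy? : ∀ t z → Dec (Heavy H t z)
  heavy? t z = H <? size t z

  basket? : ∀ t z → Dec (Basket H t z)
  basket? t z = map′ to from (any? (λ c → ¬? (c ≟ root t) ×-dec (parent t c ≟ z) ×-dec heavy? t c) (nodes t))
    where
    to : Any (λ c → c ≢ root t × parent t c ≡ z × Heavy H t c) (nodes t) → Basket H t z
    to a with find a
    ... | c , c∈ , nr , pz , h = c , (c∈ , nr , pz) , h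
    from : Basket H t z → Any (λ c → c ≢ root t × parent t c ≡ z × Heavy H t c) (nodes t)
    from (c , (c∈ , nr , pz) , h) = lose c∈ (nr , pz , h)

  -- a basket is larger than its heavy child, so it has at least H+2 nodes
  basket-size : ∀ {t} → IsTree t → ∀ {z} → Basket H t z → suc (suc H) ≤ size t z
  basket-size T (c , (c∈ , nr , refl) , hc) = ≤-trans (s≤s hc) (size-child T c∈ nr)

  basket⇒heavy : ∀ {t} → IsTree t → ∀ {z} → Basket H t z → Heavy H t z
  basket⇒heavy T b = ≤-trans (n≤1+n _) (basket-size T b)

  weightOf : ∀ {a b} {B : Set a} {Hv : Set b} → Dec B → Dec Hv → ℕ → ℕ
  weightOf (yes _) _       _ = suc H
  weightOf (no _)  (yes _) s = s
  weightOf (no _)  (no _)  _ = 0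

  weight : Tree → ℕ → ℕ
  weight t z = weightOf (basket? t z) (heavy? t z) (size t z)

  basketCount : Tree → ℕ
  basketCount t = ∑ (λ z → 𝟙 (basket? t z)) (nodes t)

  potential : Tree → ℕ
  potential t = ∑ (weight t) (nodes t)

  weight-cong : ∀ t t′ z → (Basket H t z → Basket H t′ z) → (Basket H t′ z → Basket H t z) →
                size t z ≡ size t′ z → weight t z ≡ weight t′ z
  weight-cong t t′ z f g e with basket? t z | basket? t′ z | heavy? t z | heavy? t′ z
  ... | yes _ | yes _  | _     | _      = refl
  ... | yes b | no ¬b  | _     | _      = ⊥-elim (¬b (f b))
  ... | no ¬b | yes b  | _     | _      = ⊥-elim (¬b (g b))
  ... | no _  | no _   | yes _ | yes _  = e
  ... | no _  | no _   | yes h | no ¬h  = ⊥-elim (¬h (subst (H <_) e h))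
  ... | no _  | no _   | no ¬h | yes h  = ⊥-elim (¬h (subst (H <_) (sym e) h))
  ... | no _  | no _   | no _  | no _   = refl

  weight-basket : ∀ {t z} → Basket H t z → weight t z ≡ suc H
  weight-basket {t} {z} b with basket? t z
  ... | yes _ = refl
  ... | no ¬b = ⊥-elim (¬b b)

  weight-heavy : ∀ {t z} → ¬ Basket H t z → Heavy H t z → weight t z ≡ size t z
  weight-heavy {t} {z} ¬b h with basket? t z | heavy? t z
  ... | yes b | _     = ⊥-elim (¬b b)
  ... | no _  | yes _ = refl
  ... | no _  | no ¬h = ⊥-elim (¬h h)

  weight-light : ∀ {t z} → IsTree t → ¬ Heavy H t z → weight t z ≡ 0
  weight-light {t} {z} T ¬h with basket? t z | heavy? t z
  ... | yes b | _     = ⊥-elim (¬h (basket⇒heavy T b))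
  ... | no _  | yes h = ⊥-elim (¬h h)
  ... | no _  | no _  = refl

  -- a basket is heavy, so every weight is bounded by the size
  weight≤size : ∀ {t} → IsTree t → ∀ z → weight t z ≤ size t z
  weight≤size {t} T z with basket? t z | heavy? t z
  ... | yes b | _     = basket⇒heavy T b
  ... | no _  | yes _ = ≤-refl
  ... | no _  | no _  = z≤n

  -- a tree with at most H nodes has no heavy nodes, hence both potentials vanish
  small-tree : ∀ {t} → IsTree t → length (nodes t) ≤ H → potential t ≡ 0 × basketCount t ≡ 0
  small-tree {t} T small =
    ∑-zero (weight t) (nodes t) (λ z _ → weight-light T ¬heavy) ,
    ∑-zero (λ z → 𝟙 (basket? t z)) (nodes t) (λ z _ → 𝟙-no (basket? t z) (λ b → ¬heavy (basket⇒heavy T b)))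
    where
    ¬heavy : ∀ {z} → ¬ Heavy H t z
    ¬heavy {z} h = <⇒≱ h (≤-trans (size≤length t z) small)

  potential≤root-weight : ∀ {t} → IsTree t → ¬ Basket H t (root t) → potential t ≤ length (nodes t) →
                          potential t ≤ weight t (root t)
  potential≤root-weight {t} T ¬B Q≤ = by-heaviness (heavy? t (root t))
    where
    by-heaviness : Dec (Heavy H t (root t)) → potential t ≤ weight t (root t)
    by-heaviness (yes h) = ≤-trans Q≤ (≤-reflexive (sym (trans (weight-heavy ¬B h) (size-root T))))
    by-heaviness (no ¬h) =
      ≤-trans (≤-reflexive (proj₁ (small-tree T (≤-trans (≤-reflexive (sym (size-root T))) (≮⇒≥ ¬h))))) z≤n

module PushSteps (H : ℕ) where

  open Sums
  open Sizes
  open Pushing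
  open Potential H
  open import Data.Nat using (_+_; _≤_; _<_; _≟_; s≤s)
  open import Data.Nat.Properties
  open import Data.List.Membership.Propositional using (_∈_)
  open import Data.Product using (_×_; _,_; proj₁; proj₂)
  open import Data.Sum using (_⊎_; inj₁; inj₂)
  open import Data.Empty using (⊥-elim)
  open import Data.Unit using (tt)
  open import Relation.Nullary using (¬_; yes; no)
  open import Relation.Binary.PropositionalEquality

  -- Let p be the common parent of x and y.  Baskets are never destroyed; the
  -- only possible new baskets are y (if x is heavy) and p (if y becomes
  -- heavy).  If no basket is created, only the weight of y changes: the
  -- potential can only increase, and it stays equal only for steps of the
  -- two allowed forms.
  module Step {t : Tree} (T : IsTree t) {x y : ℕ} (sib : Siblings t x y) where
    open Push T sib
    open IsTree T

    p : ℕ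
    p = parent t x

    p∈ : p ∈ nodes t
    p∈ = parent∈ x x∈ x≢root

    basket-preserved : ∀ {z} → Basket H t z → Basket H t′ z
    basket-preserved {z} (c , (c∈ , nr , pz) , hc) with c ≟ x
    ... | yes refl = y , (y∈ , y≢root , trans parent′-y pz) ,
                     <-≤-trans hc (≤-trans (m≤n+m (size t x) (size t y)) (≤-reflexive (sym size-y)))
    ... | no ne    = c , (c∈ , nr , trans (parent′-other ne) pz) , <-≤-trans hc (size-mono c)

    basket-reflected : ∀ {z} → Basket H t′ z →
                       Basket H t z ⊎ ((z ≡ y × Heavy H t x) ⊎ (z ≡ p × Heavy H t′ y))
    basket-reflected {z} (c , (c∈ , nr , pz) , hc) with c ≟ x
    ... | yes refl = inj₂ (inj₁ (trans (sym pz) parent′-x , subst (H <_) (size-other x≢y) hc))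
    ... | no ne with c ≟ y
    ...   | yes refl = inj₂ (inj₂ (trans (sym pz) parent′-y , hc))
    ...   | no ne′   = inj₁ (c , (c∈ , nr , trans (sym (parent′-other ne)) pz) , subst (H <_) (size-other ne′) hc)

    NewBasket : Set
    NewBasket = (¬ Basket H t y × Heavy H t x) ⊎ (¬ Basket H t p × Heavy H t′ y)

    basketCount-mono : basketCount t ≤ basketCount t′
    basketCount-mono = ∑-mono (nodes t) (λ z _ → 𝟙-mono (basket? t z) (basket? t′ z) basket-preserved)

    basketCount-grows-at : ∀ {z} → z ∈ nodes t → ¬ Basket H t z → Basket H t′ z → basketCount t < basketCount t′
    basketCount-grows-at {z} z∈ ¬b b =
      ∑-strict (nodes t) (λ w _ → 𝟙-mono (basket? t w) (basket? t′ w) basket-preserved) z∈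
        (≤-trans (s≤s (≤-reflexive (𝟙-no (basket? t z) ¬b))) (≤-reflexive (sym (𝟙-yes (basket? t′ z) b))))

    basketCount-grows : NewBasket → basketCount t < basketCount t′
    basketCount-grows (inj₁ (¬By , hx)) =
      basketCount-grows-at y∈ ¬By (x , (x∈ , x≢root , parent′-x) , subst (H <_) (sym (size-other x≢y)) hx)
    basketCount-grows (inj₂ (¬Bp , hy)) =
      basketCount-grows-at p∈ ¬Bp (y , (y∈ , y≢root , parent′-y) , hy)

    module NoNewBasket (no-new : ¬ NewBasket) where

      weight-other : ∀ z → z ≢ y → weight t z ≡ weight t′ z
      weight-other z ne = weight-cong t t′ z basket-preserved reflect (sym (size-other ne))
        where
        reflect : Basket H t′ z → Basket H t z
        reflect b with basket-reflected b
        ... | inj₁ b′                  = b′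
        ... | inj₂ (inj₁ (z≡y , _))    = ⊥-elim (ne z≡y)
        ... | inj₂ (inj₂ (refl , hy)) with basket? t p
        ...   | yes bp = bp
        ...   | no ¬bp = ⊥-elim (no-new (inj₂ (¬bp , hy)))

      -- so the change of potential is the change of the weight of y
      pointwise : weight t y ≤ weight t′ y → ∀ z → z ∈ nodes t → weight t z ≤ weight t′ z
      pointwise le z _ with z ≟ y
      ... | yes refl = le
      ... | no ne    = ≤-reflexive (weight-other z ne)

      potential-mono : weight t y ≤ weight t′ y → potential t ≤ potential t′
      potential-mono le = ∑-mono (nodes t) (pointwise le)

      potential-grows : weight t y < weight t′ y → potential t < potential t′
      potential-grows lt = ∑-strict (nodes t) (pointwise (<⇒≤ lt)) y∈ lt

      module NonBasketY (¬By : ¬ Basket H t y) where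
        ¬heavy-x : ¬ Heavy H t x
        ¬heavy-x hx = no-new (inj₁ (¬By , hx))

        ¬By′ : ¬ Basket H t′ y
        ¬By′ b with basket-reflected b
        ... | inj₁ b′               = ¬By b′
        ... | inj₂ (inj₁ (_ , hx))  = ¬heavy-x hx
        ... | inj₂ (inj₂ (y≡p , _)) = parent-x≢y (sym y≡p)

        -- y heavy afterwards: its weight is its size, which grew by size t x ≥ 1
        weight-y-grows : Heavy H t′ y → weight t y < weight t′ y
        weight-y-grows hy′ = begin-strict
          weight t y               ≤⟨ weight≤size T y ⟩
          size t y                 <⟨ m<m+n (size t y) (size-pos T x∈) ⟩
          size t y + size t x      ≡⟨ sym size-y ⟩
          size t′ y                ≡⟨ sym (weight-heavy ¬By′ hy′) ⟩
          weight t′ y              ∎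
          where open ≤-Reasoning

        light-step : ¬ Heavy H t′ y → GoodStep H t x y
        light-step ¬hy′ = inj₁ (light-x , light-y , light-x′ , light-y′)
          where
          light-y′ : Light H t′ y
          light-y′ = ≮⇒≥ ¬hy′
          light-y : Light H t y
          light-y = ≤-trans (size-mono y) light-y′
          light-x : Light H t x
          light-x = ≤-trans (≤-trans (m≤n+m (size t x) (size t y)) (≤-reflexive (sym size-y))) light-y′
          light-x′ : Light H t′ x
          light-x′ = subst (_≤ H) (sym (size-other x≢y)) light-x

        weight-y-light : ¬ Heavy H t′ y → weight t y ≡ weight t′ y
        weight-y-light ¬hy′ =
          trans (weight-light T (λ hy → ¬hy′ (<-≤-trans hy (size-mono y)))) (sym (weight-light T′ ¬hy′))

      step-progress : potential t ≤ potential t′ × (GoodStep H t x y ⊎ potential t < potential t′)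
      step-progress with basket? t y
      ... | yes By = potential-mono (≤-reflexive same) , inj₁ (inj₂ (By , basket-preserved By))
        where same = trans (weight-basket By) (sym (weight-basket (basket-preserved By)))
      ... | no ¬By with heavy? t′ y
      ...   | yes hy′ = <⇒≤ grows , inj₂ grows
        where grows = potential-grows (NonBasketY.weight-y-grows ¬By hy′)
      ...   | no ¬hy′ = potential-mono (≤-reflexive (NonBasketY.weight-y-light ¬By ¬hy′)) ,
                        inj₁ (NonBasketY.light-step ¬By ¬hy′)

  basketCount-seq : ∀ {t u} → PushSeq t u → IsTree t → basketCount t ≤ basketCount u
  basketCount-seq done               T = ≤-refl
  basketCount-seq (step x y sib s) T = ≤-trans (Step.basketCount-mono T sib) (basketCount-seq s (Push.T′ T sib))

  no-new-basket : ∀ {t u x y} (T : IsTree t) (sib : Siblings t x y) → PushSeq (push t x y) u →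
                  basketCount u ≤ basketCount t → ¬ Step.NewBasket T sib
  no-new-basket T sib s le new =
    <-irrefl refl (<-≤-trans (Step.basketCount-grows T sib new) (≤-trans (basketCount-seq s (Push.T′ T sib)) le))

  potential-seq : ∀ {t u} → PushSeq t u → IsTree t → basketCount u ≤ basketCount t → potential t ≤ potential u
  potential-seq done               T le = ≤-refl
  potential-seq (step x y sib s) T le =
    ≤-trans (proj₁ (Step.NoNewBasket.step-progress T sib (no-new-basket T sib s le)))
            (potential-seq s (Push.T′ T sib) (≤-trans le (Step.basketCount-mono T sib)))

  all-steps-good : ∀ {t u} (s : PushSeq t u) → IsTree t →
                   basketCount u ≤ basketCount t → potential u ≤ potential t → AllSteps (GoodStep H) s
  all-steps-good done T _ _ = tt
  all-steps-good (step {t} x y sib s) T nb≤ Q≤ = first-step-good , all-steps-good s T′ nb≤′ (≤-trans Q≤ Q≤Q′)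
    where
    T′ = Push.T′ T sib
    nb≤′ = ≤-trans nb≤ (Step.basketCount-mono T sib)
    progress = Step.NoNewBasket.step-progress T sib (no-new-basket T sib s nb≤)
    Q≤Q′ = proj₁ progress
    first-step-good : GoodStep H t x y
    first-step-good with proj₂ progress
    ... | inj₁ good  = good
    ... | inj₂ grows = ⊥-elim (<-irrefl refl (<-≤-trans grows (≤-trans (potential-seq s T′ nb≤′) Q≤)))

module Merging where

  open Sums
  open Ancestry
  open Sizes
  open import Data.Nat using (ℕ; _+_; _≟_)
  open import Data.Nat.Properties
  open import Data.List using (length; _++_)
  open import Data.List.Membership.Propositional using (_∈_)
  open import Data.List.Membership.Propositional.Properties using (∈-++⁺ˡ; ∈-++⁺ʳ; ∈-++⁻)
  open import Data.List.Membership.DecPropositional _≟_ using (_∈?_)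
  open import Data.List.Relation.Unary.Unique.Propositional.Properties using (++⁺)
  open import Data.Product using (_,_)
  open import Data.Sum using (_⊎_; inj₁; inj₂)
  open import Data.Empty using (⊥; ⊥-elim)
  open import Relation.Nullary using (yes; no)
  open import Relation.Binary.PropositionalEquality
  open import Function.Bundles using (Equivalence)
  open import Data.Nat.Tactic.RingSolver using (solve-∀)

  module Merge {t s u : Tree} (Tt : IsTree t) (Ts : IsTree s) (Tu : IsTree u)
               (disj : Disjoint t s) (u≅ : u ≅ merge t s) where
    open _≅_ u≅

    r : ℕ
    r = root t
    r′ : ℕ
    r′ = root s
    r∈ : r ∈ nodes t
    r∈ = IsTree.root∈ Tt
    r′∈ : r′ ∈ nodes s
    r′∈ = IsTree.root∈ Ts

    root-u : root u ≡ r
    root-u = sameRoot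

    ∈u⁺ : ∀ {z} → z ∈ nodes t ⊎ z ∈ nodes s → z ∈ nodes u
    ∈u⁺ (inj₁ p) = Equivalence.from (sameNodes _) (∈-++⁺ˡ p)
    ∈u⁺ (inj₂ p) = Equivalence.from (sameNodes _) (∈-++⁺ʳ (nodes t) p)

    ∈u⁻ : ∀ {z} → z ∈ nodes u → z ∈ nodes t ⊎ z ∈ nodes s
    ∈u⁻ p = ∈-++⁻ (nodes t) (Equivalence.to (sameNodes _) p)

    t≢s : ∀ {a b} → a ∈ nodes t → b ∈ nodes s → a ≢ b
    t≢s p q refl = disj _ p q

    nonroot-t : ∀ {z} → z ≢ r → z ≢ root u
    nonroot-t ne e = ne (trans e root-u)

    nonroot-s : ∀ {z} → z ∈ nodes s → z ≢ root u
    nonroot-s p e = t≢s r∈ p (sym (trans e root-u))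

    parent-t : ∀ {z} → z ∈ nodes t → z ≢ r → parent u z ≡ parent t z
    parent-t {z} p ne = trans (sameParent z (∈u⁺ (inj₁ p)) (nonroot-t ne)) merged-parent
      where
      merged-parent : parent (merge t s) z ≡ parent t z
      merged-parent with z ∈? nodes s
      ... | yes q = ⊥-elim (disj z p q)
      ... | no _  = if-≟-no z r′ (t≢s p r′∈)

    parent-s : ∀ {z} → z ∈ nodes s → z ≢ r′ → parent u z ≡ parent s z
    parent-s {z} p ne = trans (sameParent z (∈u⁺ (inj₂ p)) (nonroot-s p)) merged-parent
      where
      merged-parent : parent (merge t s) z ≡ parent s z
      merged-parent with z ∈? nodes s
      ... | yes _  = if-≟-no z r′ ne
      ... | no ¬p  = ⊥-elim (¬p p)

    parent-r′ : parent u r′ ≡ r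
    parent-r′ = trans (sameParent r′ (∈u⁺ (inj₂ r′∈)) (nonroot-s r′∈)) (if-≟-yes r′ r′ refl)

    anc-u⇒t : ∀ {a w} → Anc u a w → w ∈ nodes t → Anc t a w
    anc-u⇒t self p = self
    anc-u⇒t {a} (above {z} nr q) p =
      above nr-t (subst (Anc t a) (parent-t p nr-t)
        (anc-u⇒t q (subst (_∈ nodes t) (sym (parent-t p nr-t)) (IsTree.parent∈ Tt z p nr-t))))
      where
      nr-t : z ≢ r
      nr-t e = nr (trans e (sym root-u))

    anc-t⇒u : ∀ {a w} → Anc t a w → w ∈ nodes t → Anc u a w
    anc-t⇒u self p = self
    anc-t⇒u {a} (above {z} nr q) p =
      above (nonroot-t nr) (subst (Anc u a) (sym (parent-t p nr)) (anc-t⇒u q (IsTree.parent∈ Tt z p nr)))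

    anc-u⇒s : ∀ {a w} → Anc u a w → w ∈ nodes s → Anc s a w ⊎ a ≡ r
    anc-u⇒s self p = inj₁ self
    anc-u⇒s {a} (above {z} nr q) p with z ≟ r′
    ... | yes refl = inj₂ (trans (anc-of-root (subst (Anc u a) (trans parent-r′ (sym root-u)) q)) root-u)
    ... | no ne with anc-u⇒s q (subst (_∈ nodes s) (sym (parent-s p ne)) (IsTree.parent∈ Ts z p ne))
    ...   | inj₁ v = inj₁ (above ne (subst (Anc s a) (parent-s p ne) v))
    ...   | inj₂ e = inj₂ e

    anc-s⇒u : ∀ {a w} → Anc s a w → w ∈ nodes s → Anc u a w
    anc-s⇒u self p = self
    anc-s⇒u {a} (above {z} nr q) p =
      above (nonroot-s p) (subst (Anc u a) (sym (parent-s p nr)) (anc-s⇒u q (IsTree.parent∈ Ts z p nr)))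

    ∑-merge : ∀ f → ∑ f (nodes u) ≡ ∑ f (nodes t) + ∑ f (nodes s)
    ∑-merge f = trans (∑-sameSet f (nodes u) (nodes t ++ nodes s) (IsTree.uniq Tu)
                         (++⁺ (IsTree.uniq Tt) (IsTree.uniq Ts) (λ {v} (p , q) → disj v p q))
                         (λ z → Equivalence.to (sameNodes z)) (λ z → Equivalence.from (sameNodes z)))
                      (∑-++ f (nodes t) (nodes s))

    length-u : length (nodes u) ≡ length (nodes t) + length (nodes s)
    length-u = trans (sym (∑-1 (nodes u))) (trans (∑-merge (λ _ → 1)) (cong₂ _+_ (∑-1 (nodes t)) (∑-1 (nodes s))))

    size-r : size u r ≡ length (nodes t) + length (nodes s)
    size-r = trans (cong (size u) (sym root-u)) (trans (size-root Tu) length-u)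

    size-in-s : ∀ {a} → a ∈ nodes s → size u a ≡ size s a
    size-in-s {a} ap rewrite size≡∑below u a | size≡∑below s a | ∑-merge (below u a) =
      cong₂ _+_ (∑-zero (below u a) (nodes t) (λ w wp → below-no (λ q → disj a (anc∈ Tt (anc-u⇒t q wp) wp) ap)))
                (∑-cong (nodes s) (λ w wp → 𝟙-cong (desc? u a w) (desc? s a w)
                   (λ d → anc→desc Ts wp (within-s (anc-u⇒s (desc→anc d) wp)))
                   (λ d → anc→desc Tu (∈u⁺ (inj₂ wp)) (anc-s⇒u (desc→anc d) wp))))
      where
      within-s : ∀ {w} → Anc s a w ⊎ a ≡ r → Anc s a w
      within-s (inj₁ v) = v
      within-s (inj₂ e) = ⊥-elim (t≢s r∈ ap (sym e))

    size-in-t : ∀ {a} → a ∈ nodes t → a ≢ r → size u a ≡ size t a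
    size-in-t {a} ap ne rewrite size≡∑below u a | size≡∑below t a | ∑-merge (below u a) =
      trans (cong₂ _+_ (∑-cong (nodes t) (λ w wp → 𝟙-cong (desc? u a w) (desc? t a w)
                          (λ d → anc→desc Tt wp (anc-u⇒t (desc→anc d) wp))
                          (λ d → anc→desc Tu (∈u⁺ (inj₁ wp)) (anc-t⇒u (desc→anc d) wp))))
                       (∑-zero (below u a) (nodes s) (λ w wp → below-no (λ q → outside-s (anc-u⇒s q wp) wp))))
            (+-identityʳ _)
      where
      outside-s : ∀ {w} → Anc s a w ⊎ a ≡ r → w ∈ nodes s → ⊥
      outside-s (inj₁ v) wp = disj a ap (anc∈ Ts v wp)
      outside-s (inj₂ e) wp = ne e

    ∑-merge-update : ∀ fu ft fs → (∀ z → z ∈ nodes s → fu z ≡ fs z) → (∀ z → z ∈ nodes t → z ≢ r → fu z ≡ ft z) →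
                     ∑ fu (nodes u) + ft r ≡ ∑ ft (nodes t) + fu r + ∑ fs (nodes s)
    ∑-merge-update fu ft fs on-s on-t = begin
      ∑ fu (nodes u) + ft r                         ≡⟨ cong (_+ ft r) (∑-merge fu) ⟩
      ∑ fu (nodes t) + ∑ fu (nodes s) + ft r        ≡⟨ cong (λ k → ∑ fu (nodes t) + k + ft r) (∑-cong (nodes s) on-s) ⟩
      ∑ fu (nodes t) + ∑ fs (nodes s) + ft r        ≡⟨ swap-last (∑ fu (nodes t)) (∑ fs (nodes s)) (ft r) ⟩
      ∑ fu (nodes t) + ft r + ∑ fs (nodes s)        ≡⟨ cong (_+ ∑ fs (nodes s)) (∑-update fu ft r (nodes t) (IsTree.uniq Tt) r∈ on-t) ⟩
      ∑ ft (nodes t) + fu r + ∑ fs (nodes s)        ∎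
      where
      open ≡-Reasoning
      swap-last : ∀ a b c → a + b + c ≡ a + c + b
      swap-last = solve-∀

module UnionTrees (H : ℕ) where

  open Sums
  open Sizes
  open Merging
  open Potential H
  open import Data.Nat using (zero; suc; _+_; _*_; _≤_; _<_; _≤?_; z≤n)
  open import Data.Nat.Properties
  open import Data.List using (length)
  open import Data.List.Membership.Propositional using (_∈_)
  open import Data.Product using (_×_; _,_; proj₁; proj₂)
  open import Data.Sum using (_⊎_; inj₁; inj₂)
  open import Data.Empty using (⊥-elim)
  open import Relation.Nullary using (¬_; yes; no)
  open import Relation.Binary.PropositionalEquality
  open import Data.Nat.Tactic.RingSolver using (solve-∀)

  -- Baskets and weights of u = merge t s: nodes of s and non-root nodes of t
  -- keep their status, while the root r of t is a basket of u iff it was one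
  -- of t or s is heavy.
  module MergePotential {t s u : Tree} (Tt : IsTree t) (Ts : IsTree s) (Tu : IsTree u)
                        (disj : Disjoint t s) (u≅ : u ≅ merge t s) where
    open Merge Tt Ts Tu disj u≅

    basket-s⇒u : ∀ {a} → a ∈ nodes s → Basket H s a → Basket H u a
    basket-s⇒u ap (c , (cs , nr , pc) , hc) =
      c , (∈u⁺ (inj₂ cs) , nonroot-s cs , trans (parent-s cs nr) pc) , subst (H <_) (sym (size-in-s cs)) hc

    basket-u⇒s : ∀ {a} → a ∈ nodes s → Basket H u a → Basket H s a
    basket-u⇒s ap (c , (c∈ , nr , pc) , hc) with ∈u⁻ c∈
    ... | inj₁ ct = ⊥-elim (disj _ (subst (_∈ nodes t) (trans (sym (parent-t ct c≢r)) pc) (IsTree.parent∈ Tt c ct c≢r)) ap)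
      where
      c≢r : c ≢ r
      c≢r e = nr (trans e (sym root-u))
    ... | inj₂ cs with c Data.Nat.≟ r′
    ...   | yes refl = ⊥-elim (disj _ (subst (_∈ nodes t) (trans (sym parent-r′) pc) r∈) ap)
    ...   | no ne    = c , (cs , ne , trans (sym (parent-s cs ne)) pc) , subst (H <_) (size-in-s cs) hc

    basket-t⇒u : ∀ {a} → a ∈ nodes t → Basket H t a → Basket H u a
    basket-t⇒u ap (c , (ct , nr , pc) , hc) =
      c , (∈u⁺ (inj₁ ct) , nonroot-t nr , trans (parent-t ct nr) pc) , subst (H <_) (sym (size-in-t ct nr)) hc

    basket-u⇒t : ∀ {a} → a ∈ nodes t → Basket H u a → Basket H t a ⊎ (a ≡ r × Heavy H s r′)
    basket-u⇒t ap (c , (c∈ , nr , pc) , hc) with ∈u⁻ c∈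
    ... | inj₁ ct = inj₁ (c , (ct , c≢r , trans (sym (parent-t ct c≢r)) pc) , subst (H <_) (size-in-t ct c≢r) hc)
      where
      c≢r : c ≢ r
      c≢r e = nr (trans e (sym root-u))
    ... | inj₂ cs with c Data.Nat.≟ r′
    ...   | yes refl = inj₂ (trans (sym pc) parent-r′ , subst (H <_) (size-in-s r′∈) hc)
    ...   | no ne    = ⊥-elim (disj _ ap (subst (_∈ nodes s) (trans (sym (parent-s cs ne)) pc) (IsTree.parent∈ Ts c cs ne)))

    basket-r-from-s : Heavy H s r′ → Basket H u r
    basket-r-from-s h = r′ , (∈u⁺ (inj₂ r′∈) , nonroot-s r′∈ , parent-r′) , subst (H <_) (sym (size-in-s r′∈)) h

    basket-t-nonroot : ∀ {a} → a ∈ nodes t → a ≢ r → Basket H u a → Basket H t a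
    basket-t-nonroot ap ne b with basket-u⇒t ap b
    ... | inj₁ b′       = b′
    ... | inj₂ (e , _)  = ⊥-elim (ne e)

    -- the root weights are exchanged, all other weights are unchanged
    potential-merge : potential u + weight t r ≡ potential t + weight u r + potential s
    potential-merge = ∑-merge-update (weight u) (weight t) (weight s)
      (λ z p → weight-cong u s z (basket-u⇒s p) (basket-s⇒u p) (size-in-s p))
      (λ z p ne → weight-cong u t z (basket-t-nonroot p ne) (basket-t⇒u p) (size-in-t p ne))

    basketCount-merge : basketCount u + 𝟙 (basket? t r) ≡ basketCount t + 𝟙 (basket? u r) + basketCount s
    basketCount-merge = ∑-merge-update (λ z → 𝟙 (basket? u z)) (λ z → 𝟙 (basket? t z)) (λ z → 𝟙 (basket? s z))
      (λ z p → 𝟙-cong (basket? u z) (basket? s z) (basket-u⇒s p) (basket-s⇒u p))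
      (λ z p ne → 𝟙-cong (basket? u z) (basket? t z) (basket-t-nonroot p ne) (basket-t⇒u p))

  -- The invariant of union trees with n nodes: the potential is at most n,
  -- each basket accounts for 2(H+1) nodes, and a tree whose root is not a
  -- basket has no basket at all.
  record UnionInvariant (u : Tree) : Set where
    field
      potential≤  : potential u ≤ length (nodes u)
      baskets≤    : 2 * suc H * basketCount u ≤ length (nodes u)
      no-baskets  : ¬ Basket H u (root u) → basketCount u ≡ 0

  one-more-block : ∀ n m {a b} → 2 * n * m ≤ b → n ≤ b → b ≤ a → 2 * n * suc m ≤ a + b
  one-more-block n zero    _     n≤b b≤a =
    ≤-trans (≤-reflexive (trans (*-identityʳ (2 * n)) (cong (n +_) (+-identityʳ n))))
            (+-mono-≤ (≤-trans n≤b b≤a) n≤b)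
  one-more-block n (suc k) {a} {b} 2nm≤b _ b≤a = begin
    2 * n * suc (suc k)              ≡⟨ *-suc (2 * n) (suc k) ⟩
    2 * n + 2 * n * suc k            ≤⟨ +-monoˡ-≤ _ (≤-trans (m≤m*n (2 * n) (suc k)) (≤-trans 2nm≤b b≤a)) ⟩
    a + 2 * n * suc k                ≤⟨ +-monoʳ-≤ a 2nm≤b ⟩
    a + b                            ∎
    where open ≤-Reasoning

  module MergeInvariant {t s u : Tree} (Tt : IsTree t) (Ts : IsTree s) (Tu : IsTree u)
                        (disj : Disjoint t s) (u≅ : u ≅ merge t s)
                        (s≤t : length (nodes s) ≤ length (nodes t))
                        (It : UnionInvariant t) (Is : UnionInvariant s) where
    open Merge Tt Ts Tu disj u≅
    open MergePotential Tt Ts Tu disj u≅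
    open UnionInvariant

    a = length (nodes t)
    b = length (nodes s)

    heavy-s : ¬ b ≤ H → Heavy H s r′
    heavy-s b≰H = subst (H <_) (sym (size-root Ts)) (≰⇒> b≰H)

    ¬basket-r : b ≤ H → ¬ Basket H t r → ¬ Basket H u r
    ¬basket-r b≤H ¬Bt Bu with basket-u⇒t r∈ Bu
    ... | inj₁ Bt      = ¬Bt Bt
    ... | inj₂ (_ , h) = <⇒≱ h (≤-trans (≤-reflexive (size-root Ts)) b≤H)

    -- if r was a basket, weights of r agree; otherwise Q t ≤ weight t r
    potential-u≤ : potential u ≤ a + b
    potential-u≤ with basket? t r
    ... | yes Bt = ≤-trans (≤-reflexive Q-sum) (+-mono-≤ (potential≤ It) (potential≤ Is))
      where
      Q-sum : potential u ≡ potential t + potential s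
      Q-sum = +-cancelʳ-≡ (weight t r) _ _ (begin
        potential u + weight t r                   ≡⟨ potential-merge ⟩
        potential t + weight u r + potential s     ≡⟨ cong (λ w → potential t + w + potential s)
                                                        (trans (weight-basket (basket-t⇒u r∈ Bt)) (sym (weight-basket Bt))) ⟩
        potential t + weight t r + potential s     ≡⟨ swap-last (potential t) (weight t r) (potential s) ⟩
        potential t + potential s + weight t r     ∎)
        where
        open ≡-Reasoning
        swap-last : ∀ x y z → x + y + z ≡ x + z + y
        swap-last = solve-∀
    ... | no ¬Bt = ≤-trans Q≤root-and-s root-and-s≤
      where
      Qt≤ : potential t ≤ weight t r
      Qt≤ = potential≤root-weight Tt ¬Bt (potential≤ It)
      Q≤root-and-s : potential u ≤ weight u r + potential s
      Q≤root-and-s = +-cancelʳ-≤ (weight t r) _ _ (begin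
        potential u + weight t r                   ≡⟨ potential-merge ⟩
        potential t + weight u r + potential s     ≤⟨ +-monoˡ-≤ (potential s) (+-monoˡ-≤ (weight u r) Qt≤) ⟩
        weight t r + weight u r + potential s      ≡⟨ move-first (weight t r) (weight u r) (potential s) ⟩
        weight u r + potential s + weight t r      ∎)
        where
        open ≤-Reasoning
        move-first : ∀ x y z → x + y + z ≡ y + z + x
        move-first = solve-∀
      root-and-s≤ : weight u r + potential s ≤ a + b
      root-and-s≤ with b ≤? H
      ... | yes b≤H = begin
        weight u r + potential s   ≡⟨ cong (weight u r +_) (proj₁ (small-tree Ts b≤H)) ⟩
        weight u r + 0             ≡⟨ +-identityʳ _ ⟩
        weight u r                 ≤⟨ weight≤size Tu r ⟩
        size u r                   ≡⟨ size-r ⟩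
        a + b                      ∎
        where open ≤-Reasoning
      ... | no b≰H = +-mono-≤ (≤-trans (≤-reflexive (weight-basket (basket-r-from-s (heavy-s b≰H))))
                                        (≤-trans (≰⇒> b≰H) s≤t))
                              (potential≤ Is)

    -- a light s contributes no baskets and leaves the status of r unchanged
    baskets-light-s : b ≤ H → basketCount u ≡ basketCount t
    baskets-light-s b≤H = +-cancelʳ-≡ (𝟙 (basket? t r)) _ _ (begin
      basketCount u + 𝟙 (basket? t r)                  ≡⟨ basketCount-merge ⟩
      basketCount t + 𝟙 (basket? u r) + basketCount s  ≡⟨ cong₂ (λ k m → basketCount t + k + m)
                                                            same-root (proj₂ (small-tree Ts b≤H)) ⟩
      basketCount t + 𝟙 (basket? t r) + 0              ≡⟨ +-identityʳ _ ⟩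
      basketCount t + 𝟙 (basket? t r)                  ∎)
      where
      open ≡-Reasoning
      same-root : 𝟙 (basket? u r) ≡ 𝟙 (basket? t r)
      same-root with basket? t r
      ... | yes Bt = 𝟙-yes (basket? u r) (basket-t⇒u r∈ Bt)
      ... | no ¬Bt = 𝟙-no (basket? u r) (¬basket-r b≤H ¬Bt)

    merged-count : ¬ b ≤ H → basketCount u + 𝟙 (basket? t r) ≡ basketCount t + 1 + basketCount s
    merged-count b≰H = trans basketCount-merge
      (cong (λ k → basketCount t + k + basketCount s) (𝟙-yes (basket? u r) (basket-r-from-s (heavy-s b≰H))))

    -- a heavy s makes r a basket: the baskets of u are those of t and s,
    -- plus r if it was not already a basket (and then t had no basket)
    baskets-heavy-s : ¬ b ≤ H → 2 * suc H * basketCount u ≤ a + b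
    baskets-heavy-s b≰H with basket? t r
    ... | yes Bt = subst (λ k → 2 * suc H * k ≤ a + b) (sym sum-count)
                     (≤-trans (≤-reflexive (*-distribˡ-+ (2 * suc H) (basketCount t) (basketCount s)))
                              (+-mono-≤ (baskets≤ It) (baskets≤ Is)))
      where
      sum-count : basketCount u ≡ basketCount t + basketCount s
      sum-count = +-cancelʳ-≡ 1 _ _ (begin
        basketCount u + 1                       ≡⟨ cong (basketCount u +_) (sym (𝟙-yes (basket? t r) Bt)) ⟩
        basketCount u + 𝟙 (basket? t r)         ≡⟨ merged-count b≰H ⟩
        basketCount t + 1 + basketCount s       ≡⟨ swap-last (basketCount t) 1 (basketCount s) ⟩
        basketCount t + basketCount s + 1       ∎)
        where
        open ≡-Reasoning
        swap-last : ∀ x y z → x + y + z ≡ x + z + y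
        swap-last = solve-∀
    ... | no ¬Bt = subst (λ k → 2 * suc H * k ≤ a + b) (sym one-more)
                     (one-more-block (suc H) (basketCount s) (baskets≤ Is) (≰⇒> b≰H) s≤t)
      where
      one-more : basketCount u ≡ suc (basketCount s)
      one-more = begin
        basketCount u                            ≡⟨ sym (+-identityʳ _) ⟩
        basketCount u + 0                        ≡⟨ cong (basketCount u +_) (sym (𝟙-no (basket? t r) ¬Bt)) ⟩
        basketCount u + 𝟙 (basket? t r)          ≡⟨ merged-count b≰H ⟩
        basketCount t + 1 + basketCount s        ≡⟨ cong (λ k → k + 1 + basketCount s) (no-baskets It ¬Bt) ⟩
        suc (basketCount s)                      ∎
        where open ≡-Reasoning

    no-baskets-u : ¬ Basket H u (root u) → basketCount u ≡ 0
    no-baskets-u ¬Bu with b ≤? H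
    ... | yes b≤H = trans (baskets-light-s b≤H) (no-baskets It (λ Bt → ¬Bu (subst (Basket H u) (sym root-u) (basket-t⇒u r∈ Bt))))
    ... | no b≰H  = ⊥-elim (¬Bu (subst (Basket H u) (sym root-u) (basket-r-from-s (heavy-s b≰H))))

    baskets-u≤ : 2 * suc H * basketCount u ≤ a + b
    baskets-u≤ with b ≤? H
    ... | yes b≤H = subst (λ k → 2 * suc H * k ≤ a + b) (sym (baskets-light-s b≤H)) (≤-trans (baskets≤ It) (m≤m+n a b))
    ... | no b≰H  = baskets-heavy-s b≰H

    invariant : UnionInvariant u
    invariant = record
      { potential≤  = subst (potential u ≤_) (sym length-u) potential-u≤
      ; baskets≤    = subst (2 * suc H * basketCount u ≤_) (sym length-u) baskets-u≤
      ; no-baskets  = no-baskets-u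
      }

  isTree : ∀ {u} → UnionTree u → IsTree u
  isTree (single T _)         = T
  isTree (merged _ _ _ _ T _) = T

  union-invariant : 0 < H → ∀ {u} → UnionTree u → UnionInvariant u
  union-invariant H>0 (single {u} T one-node) = record
    { potential≤  = ≤-trans (≤-reflexive Q≡0) z≤n
    ; baskets≤    = ≤-trans (≤-reflexive (trans (cong (2 * suc H *_) nb≡0) (*-zeroʳ (2 * suc H)))) z≤n
    ; no-baskets  = λ _ → nb≡0
    }
    where
    small : length (nodes u) ≤ H
    small = subst (_≤ H) (sym (cong length one-node)) H>0
    Q≡0 = proj₁ (small-tree T small)
    nb≡0 = proj₂ (small-tree T small)
  union-invariant H>0 (merged ut us disj s≤t Tu u≅) =
    MergeInvariant.invariant (isTree ut) (isTree us) Tu disj u≅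
      (subst₂ _≤_ (size-root (isTree us)) (size-root (isTree ut)) s≤t)
      (union-invariant H>0 ut) (union-invariant H>0 us)

module FlatTrees (H K : ℕ) where

  open Sums
  open Sizes
  open Potential H
  open import Data.Nat using (suc; _+_; _*_; _≤_; _<_; _≟_; _≤?_)
  open import Data.Nat.Properties
  open import Data.List using (List; _∷_; []; length; _++_)
  open import Data.List.Membership.Propositional using (_∈_)
  open import Data.List.Membership.Propositional.Properties using (∈-++⁺ˡ; ∈-++⁺ʳ)
  open import Data.List.Relation.Unary.Any using (here; there)
  import Data.List.Relation.Unary.All as All
  open import Data.List.Relation.Unary.AllPairs using (_∷_)
  open import Data.List.Relation.Unary.Unique.Propositional using (Unique)
  open import Data.Product using (_×_; _,_; proj₁; proj₂)
  open import Relation.Nullary using (¬_; Dec; yes; no)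
  open import Relation.Nullary.Decidable using (_×-dec_; ¬?)
  open import Relation.Binary.PropositionalEquality
  open import Function.Bundles using (Equivalence)
  open import Data.Nat.Tactic.RingSolver using (solve-∀)

  Solid : Tree → ℕ → Set
  Solid t z = ¬ Basket H t z × Heavy H t z

  solid? : ∀ t z → Dec (Solid t z)
  solid? t z = ¬? (basket? t z) ×-dec heavy? t z

  weight≥ : ∀ t z → suc H * 𝟙 (basket? t z) + suc H * 𝟙 (solid? t z) ≤ weight t z
  weight≥ t z with basket? t z | heavy? t z
  ... | yes _ | _     = ≤-reflexive (trans (cong₂ _+_ (*-identityʳ (suc H)) (*-zeroʳ (suc H))) (+-identityʳ _))
  ... | no _  | yes h = ≤-trans (≤-reflexive (cong (_+ suc H * 1) (*-zeroʳ (suc H)))) (≤-trans (≤-reflexive (*-identityʳ (suc H))) h)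
  ... | no _  | no _  = ≤-reflexive (cong₂ _+_ (*-zeroʳ (suc H)) (*-zeroʳ (suc H)))

  -- Counting in a flat tree t₀: the root and the K depth-one baskets give
  -- K+1 baskets, each with a solid child, so the potential is at least
  -- 2(H+1)(K+1); summing the sizes of the depth-one nodes shows that t₀ has
  -- at most 2(H+1)(K+1) nodes.
  module Flatness {t₀ : Tree} (T₀ : IsTree t₀) (flat : Flat H K t₀) where
    open Flat flat
    open IsTree T₀

    ρ : ℕ
    ρ = root t₀

    basket-spec : ∀ {b} → b ∈ baskets → DepthOne t₀ b × Basket H t₀ b
    basket-spec = Equivalence.to (basketsSpec _)

    module EmptyBasket {b} (b∈ : b ∈ baskets) where
      c : ℕ
      c = proj₁ (basketsEmpty b b∈)
      c-child : Child t₀ c b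
      c-child = proj₁ (proj₂ (basketsEmpty b b∈))
      c-size : size t₀ c ≡ suc H
      c-size = proj₁ (proj₂ (proj₂ (basketsEmpty b b∈)))
      only-child : ∀ c′ → Child t₀ c′ b → c′ ≡ c
      only-child = proj₂ (proj₂ (proj₂ (basketsEmpty b b∈)))

      c-solid : Solid t₀ c
      c-solid = (λ B → <⇒≱ (basket-size T₀ B) (≤-reflexive c-size))
              , ≤-reflexive (sym c-size)

      size≤ : size t₀ b ≤ suc (suc H)
      size≤ = ≤-trans (size-decompose T₀ b (c ∷ []) (λ c′ c′∈ nr pc′ → here (only-child c′ (c′∈ , nr , pc′))))
                      (≤-reflexive (cong suc (trans (+-identityʳ _) c-size)))

    ρ∷baskets-unique : Unique (ρ ∷ baskets)
    ρ∷baskets-unique = All.tabulate (λ b∈ ρ≡b → proj₁ (proj₂ (proj₁ (basket-spec b∈))) (sym ρ≡b)) ∷ basketsUniq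

    ρ-basket : Basket H t₀ ρ
    ρ-basket = h , proj₁ hSpec , proj₂ (proj₂ hSpec)

    basketCount≥ : suc K ≤ basketCount t₀
    basketCount≥ = subst (_≤ basketCount t₀) (cong suc basketsLen)
      (length≤count (basket? t₀) (ρ ∷ baskets) (nodes t₀) ρ∷baskets-unique are-baskets)
      where
      are-baskets : ∀ z → z ∈ ρ ∷ baskets → z ∈ nodes t₀ × Basket H t₀ z
      are-baskets z (here refl) = root∈ , ρ-basket
      are-baskets z (there b∈)  = proj₁ (proj₁ (basket-spec b∈)) , proj₂ (basket-spec b∈)

    -- h is a solid child of ρ, and the child of a basket b is a solid child of b
    has-solid-child : ∀ b → b ∈ ρ ∷ baskets → 1 ≤ childCount t₀ (solid? t₀) b
    has-solid-child b (here refl) = solid-child (proj₁ hSpec) (proj₂ hSpec)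
      where
      solid-child : ∀ {c} → Child t₀ c ρ → Solid t₀ c → 1 ≤ childCount t₀ (solid? t₀) ρ
      solid-child {c} (c∈ , nr , pc) s =
        ≤-trans (≤-reflexive (sym (𝟙-yes ((¬? (c ≟ ρ) ×-dec (parent t₀ c ≟ ρ)) ×-dec solid? t₀ c) ((nr , pc) , s))))
                (∑-term _ (nodes t₀) c∈)
    has-solid-child b (there b∈) =
      ≤-trans (≤-reflexive (sym (𝟙-yes ((¬? (c ≟ ρ) ×-dec (parent t₀ c ≟ b)) ×-dec solid? t₀ c) ((nr , pc) , c-solid))))
              (∑-term _ (nodes t₀) c∈)
      where
      open EmptyBasket b∈
      c∈ = proj₁ c-child
      nr = proj₁ (proj₂ c-child)
      pc = proj₂ (proj₂ c-child)

    solidCount≥ : suc K ≤ ∑ (λ z → 𝟙 (solid? t₀ z)) (nodes t₀)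
    solidCount≥ = begin
      suc K                                               ≡⟨ cong suc (sym basketsLen) ⟩
      length (ρ ∷ baskets)                                ≡⟨ sym (∑-1 (ρ ∷ baskets)) ⟩
      ∑ (λ _ → 1) (ρ ∷ baskets)                           ≤⟨ ∑-mono (ρ ∷ baskets) has-solid-child ⟩
      ∑ (childCount t₀ (solid? t₀)) (ρ ∷ baskets)         ≤⟨ ∑-childCount T₀ (solid? t₀) (ρ ∷ baskets) ρ∷baskets-unique ⟩
      ∑ (λ z → 𝟙 (solid? t₀ z)) (nodes t₀)                ∎
      where open ≤-Reasoning

    potential≥ : 2 * suc H * suc K ≤ potential t₀
    potential≥ = begin
      2 * suc H * suc K
        ≡⟨ double (suc H) (suc K) ⟩
      suc H * suc K + suc H * suc K
        ≤⟨ +-mono-≤ (*-monoʳ-≤ (suc H) basketCount≥) (*-monoʳ-≤ (suc H) solidCount≥) ⟩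
      suc H * basketCount t₀ + suc H * ∑ (λ z → 𝟙 (solid? t₀ z)) (nodes t₀)
        ≡⟨ sym (trans (∑-+ _ _ (nodes t₀)) (cong₂ _+_ (∑-* (suc H) _ (nodes t₀)) (∑-* (suc H) _ (nodes t₀)))) ⟩
      ∑ (λ z → suc H * 𝟙 (basket? t₀ z) + suc H * 𝟙 (solid? t₀ z)) (nodes t₀)
        ≤⟨ ∑-mono (nodes t₀) (λ z _ → weight≥ t₀ z) ⟩
      potential t₀
        ∎
      where
      open ≤-Reasoning
      double : ∀ a b → 2 * a * b ≡ a * b + a * b
      double = solve-∀

    -- every depth-one node is a basket, h, or light
    depth-one : List ℕ
    depth-one = baskets ++ h ∷ lights

    children-of-ρ : ∀ c → c ∈ nodes t₀ → c ≢ ρ → parent t₀ c ≡ ρ → c ∈ depth-one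
    children-of-ρ c c∈ nr pc with size t₀ c ≤? H
    ... | yes light = ∈-++⁺ʳ baskets (there (Equivalence.from (lightsSpec c) ((c∈ , nr , pc) , light)))
    ... | no heavy with basket? t₀ c
    ...   | yes B = ∈-++⁺ˡ (Equivalence.from (basketsSpec c) ((c∈ , nr , pc) , B))
    ...   | no ¬B = ∈-++⁺ʳ baskets (here (hUnique c (c∈ , nr , pc) ¬B (≰⇒> heavy)))

    nodes≤ : length (nodes t₀) ≤ 2 * suc H * suc K
    nodes≤ = begin
      length (nodes t₀)                                      ≡⟨ sym (size-root T₀) ⟩
      size t₀ ρ                                              ≤⟨ size-decompose T₀ ρ depth-one children-of-ρ ⟩
      1 + ∑ (size t₀) depth-one                              ≡⟨ cong suc split-sum ⟩
      1 + (∑ (size t₀) baskets + (size t₀ h + suc K * H))    ≤⟨ +-monoʳ-≤ 1 (+-mono-≤ baskets≤ (≤-reflexive (cong (_+ suc K * H) hSize))) ⟩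
      1 + (K * suc (suc H) + (suc H + suc K * H))            ≡⟨ arithmetic H K ⟩
      2 * suc H * suc K                                      ∎
      where
      open ≤-Reasoning
      split-sum : ∑ (size t₀) depth-one ≡ ∑ (size t₀) baskets + (size t₀ h + suc K * H)
      split-sum = trans (∑-++ (size t₀) baskets (h ∷ lights))
                        (cong (λ k → ∑ (size t₀) baskets + (size t₀ h + k)) (trans (∑≡sum∘map (size t₀) lights) lightsSum))
      baskets≤ : ∑ (size t₀) baskets ≤ K * suc (suc H)
      baskets≤ = ≤-trans (∑-bound (size t₀) (suc (suc H)) baskets (λ b b∈ → EmptyBasket.size≤ b∈))
                         (≤-reflexive (cong (_* suc (suc H)) basketsLen))
      arithmetic : ∀ H K → 1 + (K * suc (suc H) + (suc H + suc K * H)) ≡ 2 * suc H * suc K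
      arithmetic = solve-∀

open import Data.Nat using (suc; _*_; _≤_)
open import Data.Nat.Properties using (≤-trans; *-cancelˡ-≤)
open import Data.List using (length)
open import Relation.Binary.PropositionalEquality using (subst; sym)
open Pushing using (nodes-seq)

-- Comparing the invariant of the Union tree t with the counts for the flat
-- tree t₀, which has the same nodes, bounds the number of baskets and the
-- potential of t by those of t₀.
lemma2 : (H K : ℕ) → 0 < H → 0 < K → (t₀ t : Tree) → IsTree t₀ → Flat H K t₀ →
         UnionTree t → (seq : PushSeq t₀ t) → AllSteps (GoodStep H) seq
lemma2 H K H>0 _ t₀ t T₀ flat union seq = all-steps-good seq T₀ basketCount-t≤ potential-t≤
  where
  open Potential H
  open PushSteps H
  open UnionTrees H
  open UnionInvariant (union-invariant H>0 union)
  open FlatTrees.Flatness H K T₀ flat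
  -- t has the nodes of t₀, at most 2(H+1)(K+1) of them
  few-nodes : length (nodes t) ≤ 2 * suc H * suc K
  few-nodes = subst (λ ns → length ns ≤ 2 * suc H * suc K) (sym (nodes-seq seq)) nodes≤
  potential-t≤ : potential t ≤ potential t₀
  potential-t≤ = ≤-trans potential≤ (≤-trans few-nodes potential≥)
  basketCount-t≤ : basketCount t ≤ basketCount t₀
  basketCount-t≤ = ≤-trans (*-cancelˡ-≤ (2 * suc H) (≤-trans baskets≤ few-nodes)) basketCount≥
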